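{- Let $r\ge2$ and let $H$ be a fixed ordered $r$-matching. Then a.a.s.\ $\mathbb{RM}^{(r)}_{n}$ contains a copy of $H$, i.e., a sub-matching order-isomorphic to $H$.
   Context: An ordered $r$-matching of size $n$ is a set of $n$ pairwise disjoint $r$-element subsets (edges) of a linearly ordered vertex set of size $rn$. Two ordered hypergraphs are order-isomorphic if there is an isomorphism between them preserving the linear orders. $\mathbb{RM}^{(r)}_{n}$ is an ordered $r$-matching on $[rn]$ chosen uniformly at random among all such matchings; a.a.s.\ means with probability tending to $1$ as $n\to\infty$. -}

module Defs where

open import Data.Nat using (ℕ; zero; suc; _+_; _*_)
open import Data.Fin using (Fin; inject₁; _<_; _<?_)
open import Data.Fin.Properties using (_≟_; any?; all?)
open import Data.Vec using (Vec; []; _∷_; lookup; count)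
open import Data.Product using (Σ; ∃; _×_; _,_)
open import Relation.Nullary using (Dec; yes; no; does; ¬_)
open import Relation.Nullary.Decidable using (_×-dec_; _→-dec_; ¬?)
open import Relation.Binary.PropositionalEquality using (_≡_)
open import Data.Bool using (if_then_else_)

-- An ordered r-matching of size n on the vertex set [r n] = Fin (r * n)
-- (ordered as Fin) is encoded canonically as a vector M assigning to each
-- vertex the label (in Fin n) of the edge containing it, where
--  * every label class has exactly r vertices (edges are r-sets), and
--  * labels are given in order of the edges' minimum vertices:
--    whenever a vertex v has label l, every label j < l already occurs
--    at some vertex u < v (so edges are numbered by their minima).
-- This is a bijection with the set of ordered r-matchings of size n.

EdgeSizes : (r n : ℕ) → Vec (Fin n) (r * n) → Set
EdgeSizes r n M = (j : Fin n) → count (_≟ j) M ≡ r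

Canonical : (r n : ℕ) → Vec (Fin n) (r * n) → Set
Canonical r n M = (v : Fin (r * n)) (j : Fin n) →
  j < lookup M v → ∃ λ u → u < v × lookup M u ≡ j

IsMatching : (r n : ℕ) → Vec (Fin n) (r * n) → Set
IsMatching r n M = EdgeSizes r n M × Canonical r n M

isMatching? : (r n : ℕ) → (M : Vec (Fin n) (r * n)) → Dec (IsMatching r n M)
isMatching? r n M =
  all? (λ j → Data.Nat._≟_ (count (_≟ j) M) r)
  ×-dec
  all? (λ v → all? (λ j → (j <? lookup M v) →-dec
     any? (λ u → (u <? v) ×-dec (lookup M u ≟ j))))
  where import Data.Nat

-- φ : Fin (r*m) → Fin (r*n) (as a vector) embeds the matching H into M:
-- φ is strictly increasing, and two vertices lie in a common edge of H
-- iff their images lie in a common edge of M.  Then the image of φ is a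
-- sub-matching of M (a union of m edges of M) order-isomorphic to H via φ.
Embeds : (r m n : ℕ) → Vec (Fin m) (r * m) → Vec (Fin n) (r * n) →
         Vec (Fin (r * n)) (r * m) → Set
Embeds r m n H M φ =
  ((u v : Fin (r * m)) → u < v → lookup φ u < lookup φ v) ×
  ((u v : Fin (r * m)) →
     (lookup H u ≡ lookup H v → lookup M (lookup φ u) ≡ lookup M (lookup φ v)) ×
     (lookup M (lookup φ u) ≡ lookup M (lookup φ v) → lookup H u ≡ lookup H v))

embeds? : (r m n : ℕ) → (H : Vec (Fin m) (r * m)) → (M : Vec (Fin n) (r * n)) →
          (φ : Vec (Fin (r * n)) (r * m)) → Dec (Embeds r m n H M φ)
embeds? r m n H M φ =
  all? (λ u → all? (λ v → (u <? v) →-dec (lookup φ u <? lookup φ v)))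
  ×-dec
  all? (λ u → all? (λ v →
     ((lookup H u ≟ lookup H v) →-dec (lookup M (lookup φ u) ≟ lookup M (lookup φ v)))
     ×-dec
     ((lookup M (lookup φ u) ≟ lookup M (lookup φ v)) →-dec (lookup H u ≟ lookup H v))))

∃vec? : {A : Set} (anyA : ∀ {Q : A → Set} → (∀ a → Dec (Q a)) → Dec (∃ Q)) →
        (k : ℕ) {P : Vec A k → Set} → (∀ v → Dec (P v)) → Dec (∃ P)
∃vec? anyA zero P? with P? []
... | yes p = yes ([] , p)
... | no ¬p = no λ { ([] , p) → ¬p p }
∃vec? anyA (suc k) {P} P? with anyA (λ a → ∃vec? anyA k (λ v → P? (a ∷ v)))
... | yes (a , v , p) = yes (a ∷ v , p)
... | no ¬q = no λ { (a ∷ v , p) → ¬q (a , v , p) }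

Contains : (r m n : ℕ) → Vec (Fin m) (r * m) → Vec (Fin n) (r * n) → Set
Contains r m n H M = ∃ λ φ → Embeds r m n H M φ

contains? : (r m n : ℕ) → (H : Vec (Fin m) (r * m)) → (M : Vec (Fin n) (r * n)) →
            Dec (Contains r m n H M)
contains? r m n H M = ∃vec? any? (r * m) (embeds? r m n H M)

countVec : (k m : ℕ) {P : Vec (Fin m) k → Set} → (∀ v → Dec (P v)) → ℕ
countVec zero m P? = if does (P? []) then 1 else 0
countVec (suc k) m P? = sumFin (λ a → countVec k m (λ v → P? (a ∷ v)))
  where
  sumFin : ∀ {l} → (Fin l → ℕ) → ℕ
  sumFin {zero} f = 0
  sumFin {suc l} f = f Data.Fin.zero + sumFin (λ i → f (Data.Fin.suc i))

numMatchings : (r n : ℕ) → ℕ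
numMatchings r n = countVec (r * n) n (isMatching? r n)

numAvoiding : (r m : ℕ) → Vec (Fin m) (r * m) → (n : ℕ) → ℕ
numAvoiding r m H n =
  countVec (r * n) n (λ M → isMatching? r n M ×-dec ¬? (contains? r m n H M))

-- Write Tₙ for the number of ordered r-matchings with n edges and Aₙ for the number of those
-- avoiding H, where H has m edges.  Choosing m of the m + n′ edges of a matching splits it into a
-- matching with m edges on the r m vertices they cover and one with n′ edges on the remaining
-- vertices; conversely, a set of r m vertices carrying a matching with m edges, together with a
-- matching with n′ edges on the other vertices, merges back in exactly one way.  Hence
--   Tₘ₊ₙ′ · C(m + n′, m) = C(r (m + n′), r m) · Tₘ · Tₙ′ ,
-- while both parts of a matching avoiding H avoid H, so
--   Aₘ₊ₙ′ · C(m + n′, m) ≤ C(r (m + n′), r m) · Aₘ · Aₙ′ .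
-- Dividing, Aₘ₊ₙ′ / Tₘ₊ₙ′ ≤ (Aₘ / Tₘ) · Aₙ′ / Tₙ′, and Aₘ < Tₘ because H does not avoid itself,
-- so Aₙ / Tₙ ≤ (Aₘ / Tₘ)^⌊n/m⌋ tends to 0.
--
-- Restricting
-- to a set of edges and merging two matchings require relabelling; a labelling in this canonical
-- form is determined by the partition of the vertices it induces.

module Submission where

open import Defs
open import Data.Bool using (Bool; true; false; if_then_else_)
open import Data.Empty using (⊥-elim)
open import Data.Fin as Fin using (Fin; zero; suc; toℕ; _<_; _<?_; join; splitAt)
open import Data.Fin.Induction using (<-wellFounded)
open import Data.Fin.Properties
  using (_≟_; toℕ-cast; toℕ-injective; cast-involutive; <-cmp; <-irrefl; <-asym; all?; any?;
         injective⇒≤; join-splitAt; splitAt-join)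
open import Data.Fin.Subset using (Subset; inside; outside; ∣_∣; ∁; _∈_) renaming (⊤ to full; ⊥ to empty)
open import Data.Fin.Subset.Properties using (x∈∁p⇒x∉p; x∉p⇒x∈∁p; ∣∁p∣≡n∸∣p∣; ∣⊥∣≡0; _∈?_)
open import Data.List as List using (List; length; filter; cartesianProduct; cartesianProductWith)
open import Data.List.Membership.Propositional using () renaming (_∈_ to _∈ₗ_)
open import Data.List.Membership.Propositional.Properties
  using (∈-∃++; ∈-++⁻; ∈-++⁺ˡ; ∈-++⁺ʳ; ∈-filter⁺; ∈-filter⁻; ∈-allFin;
         ∈-cartesianProduct⁺; ∈-cartesianProductWith⁺)
open import Data.List.Properties using (length-++; filter-++; filter-≐; filter-none)
open import Data.List.Relation.Binary.Subset.Propositional using (_⊆_)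
open import Data.List.Relation.Unary.All as All using (All; []; _∷_)
open import Data.List.Relation.Unary.All.Properties using (all-filter)
open import Data.List.Relation.Unary.AllPairs using ([]; _∷_)
open import Data.List.Relation.Unary.Any using (here; there)
open import Data.List.Relation.Unary.Unique.Propositional using (Unique)
import Data.List.Relation.Unary.Unique.Propositional.Properties as Unique
open import Data.Nat as ℕ using (ℕ; zero; suc; _+_; _*_; _^_; _∸_; _≤_; z≤n; s≤s; NonZero)
open import Data.Nat.Properties
  using (+-suc; +-comm; +-identityʳ; *-suc; *-zeroʳ; *-comm; *-assoc; *-identityˡ; *-distribˡ-+;
         ≤-trans; ≤-antisym; <-≤-trans; n≤1+n; m≤n*m; n≤0⇒n≡0; +-mono-≤; *-monoˡ-≤; *-monoʳ-≤;
         ^-monoˡ-≤; *-cancelˡ-≡; *-cancelˡ-≤; *-cancelʳ-≤; m+n∸m≡n; m+[n∸m]≡n; m+n≤o⇒m≤o;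
         m+n≤o⇒m≤o∸n; m^n>0; +-0-commutativeMonoid; module ≤-Reasoning)
open import Algebra.Properties.CommutativeMonoid.Sum +-0-commutativeMonoid
  using (sum-syntax; sum-cong-≗; ∑-distrib-+)
open import Data.Nat.Tactic.RingSolver using (solve-∀)
open import Data.Product using (∃; ∃₂; _×_; _,_; proj₁; proj₂)
open import Data.Sum using (_⊎_; inj₁; inj₂; [_,_]′)
import Data.Sum.Properties as Sum
open import Data.Vec as Vec using (Vec; []; _∷_; here; there; lookup; tabulate; map; count)
open import Data.Vec.Properties
  using (∷-injective; lookup-map; lookup-cast; lookup∘tabulate; tabulate∘lookup; tabulate-cong;
         []=⇒lookup; lookup⇒[]=)
open import Function using (_∘_; id; const; _⇔_; mk⇔; Equivalence)
import Induction.WellFounded as WF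
open import Level using (0ℓ)
open import Relation.Binary using (Rel; _⇒_; DecidableEquality; tri<; tri≈; tri>)
open import Relation.Binary.PropositionalEquality
  using (_≡_; _≢_; _≗_; refl; sym; trans; cong; cong₂; subst; subst₂; module ≡-Reasoning)
open import Relation.Nullary using (Dec; yes; no; does; ¬_; contradiction)
open import Relation.Nullary.Decidable using (_×-dec_; _→-dec_; ¬?; dec-true)
open import Relation.Unary using (Pred; Decidable; _⟨×⟩_)
open import Relation.Unary.Properties using (U?; _×?_)

private
  variable
    X Y Z : Set
    a b k K : ℕ

-- Counting elements of finite types

record Listing (X : Set) : Set where
  field
    elements : List X
    complete : ∀ x → x ∈ₗ elements
    unique   : Unique elements
open Listing

#[_]_ : {P : Pred X 0ℓ} → Listing X → Decidable P → ℕ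
#[ E ] P? = length (filter P? (elements E))

Unique-⊆⇒length≤ : {xs ys : List X} → Unique xs → xs ⊆ ys → length xs ≤ length ys
Unique-⊆⇒length≤ {xs = List.[]} _ _ = z≤n
Unique-⊆⇒length≤ {xs = x List.∷ xs} (x∉xs ∷ xs!) xs⊆ys with ∈-∃++ (xs⊆ys (here refl))
... | ys₁ , ys₂ , refl = begin
  suc (length xs)                ≤⟨ s≤s (Unique-⊆⇒length≤ xs! xs⊆ys₁++ys₂) ⟩
  suc (length (ys₁ List.++ ys₂)) ≡⟨ cong suc (length-++ ys₁) ⟩
  suc (length ys₁ + length ys₂)  ≡⟨ +-suc (length ys₁) (length ys₂) ⟨
  length ys₁ + suc (length ys₂)  ≡⟨ length-++ ys₁ ⟨
  length (ys₁ List.++ x List.∷ ys₂) ∎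
  where
  open ≤-Reasoning
  xs⊆ys₁++ys₂ : xs ⊆ ys₁ List.++ ys₂
  xs⊆ys₁++ys₂ y∈xs with ∈-++⁻ ys₁ (xs⊆ys (there y∈xs))
  ... | inj₁ y∈ys₁         = ∈-++⁺ˡ y∈ys₁
  ... | inj₂ (here refl)   = ⊥-elim (All.lookup x∉xs y∈xs refl)
  ... | inj₂ (there y∈ys₂) = ∈-++⁺ʳ ys₁ y∈ys₂

module _ {P : Pred X 0ℓ} (f : ∀ {x} → P x → Y) where

  length-reduce : ∀ {xs} (ps : All P xs) → length (All.reduce f ps) ≡ length xs
  length-reduce []       = refl
  length-reduce (_ ∷ ps) = cong suc (length-reduce ps)

  ∈-reduce⁻ : ∀ {xs y} (ps : All P xs) → y ∈ₗ All.reduce f ps → ∃₂ λ x (p : P x) → x ∈ₗ xs × y ≡ f p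
  ∈-reduce⁻ (p ∷ ps) (here refl) = _ , p , here refl , refl
  ∈-reduce⁻ (p ∷ ps) (there y∈)  with x , q , x∈xs , y≡fq ← ∈-reduce⁻ ps y∈ = x , q , there x∈xs , y≡fq

  Unique-reduce : (∀ x x′ (p : P x) (p′ : P x′) → f p ≡ f p′ → x ≡ x′) →
                  ∀ {xs} → Unique xs → (ps : All P xs) → Unique (All.reduce f ps)
  Unique-reduce f-inj []           []       = []
  Unique-reduce f-inj (x∉xs ∷ xs!) (p ∷ ps) = All.tabulate fp∉ ∷ Unique-reduce f-inj xs! ps
    where
    fp∉ : ∀ {y} → y ∈ₗ All.reduce f ps → f p ≢ y
    fp∉ y∈ fp≡y with x′ , q , x′∈xs , refl ← ∈-reduce⁻ ps y∈ = All.lookup x∉xs x′∈xs (f-inj _ _ p q fp≡y)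

#-injection : (EX : Listing X) (EY : Listing Y) {P : Pred X 0ℓ} {Q : Pred Y 0ℓ}
  (P? : Decidable P) (Q? : Decidable Q) (f : ∀ x → P x → Y) → (∀ x (p : P x) → Q (f x p)) →
  (∀ x x′ (p : P x) (p′ : P x′) → f x p ≡ f x′ p′ → x ≡ x′) → #[ EX ] P? ≤ #[ EY ] Q?
#-injection {Y = Y} EX EY {P} P? Q? f f∈Q f-inj = begin
  #[ EX ] P?                ≡⟨ length-reduce f′ Ps ⟨
  length (All.reduce f′ Ps) ≤⟨ Unique-⊆⇒length≤ (Unique-reduce f′ f-inj (Unique.filter⁺ P? (unique EX)) Ps)
                                                 image⊆ ⟩
  #[ EY ] Q?                ∎
  where
  open ≤-Reasoning
  f′ : ∀ {x} → P x → Y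
  f′ {x} = f x
  Ps : All P (filter P? (elements EX))
  Ps = all-filter P? (elements EX)
  image⊆ : All.reduce f′ Ps ⊆ filter Q? (elements EY)
  image⊆ y∈ with x , p , _ , refl ← ∈-reduce⁻ f′ Ps y∈ = ∈-filter⁺ Q? (complete EY _) (f∈Q x p)

#-< : (E : Listing X) {P Q : Pred X 0ℓ} (P? : Decidable P) (Q? : Decidable Q) (y : X) →
      (∀ {x} → P x → Q x) → Q y → ¬ P y → suc (#[ E ] P?) ≤ #[ E ] Q?
#-< E P? Q? y P⇒Q Qy ¬Py = Unique-⊆⇒length≤ (All.tabulate y∉ ∷ Unique.filter⁺ P? (unique E)) y∷P⊆Q
  where
  y∉ : ∀ {x} → x ∈ₗ filter P? (elements E) → y ≢ x
  y∉ x∈ refl = ¬Py (proj₂ (∈-filter⁻ P? {xs = elements E} x∈))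
  y∷P⊆Q : y List.∷ filter P? (elements E) ⊆ filter Q? (elements E)
  y∷P⊆Q (here refl) = ∈-filter⁺ Q? (complete E y) Qy
  y∷P⊆Q (there x∈) with x∈E , Px ← ∈-filter⁻ P? {xs = elements E} x∈ = ∈-filter⁺ Q? x∈E (P⇒Q Px)

#-positive : (E : Listing X) {P : Pred X 0ℓ} (P? : Decidable P) (x : X) → P x → 1 ≤ #[ E ] P?
#-positive E P? x Px = Unique-⊆⇒length≤ ([] ∷ []) λ { (here refl) → ∈-filter⁺ P? (complete E x) Px }

length-filter-map : {P : Pred Y 0ℓ} (P? : Decidable P) (f : X → Y) (xs : List X) →
  length (filter P? (List.map f xs)) ≡ length (filter (P? ∘ f) xs)
length-filter-map P? f List.[]         = refl
length-filter-map P? f (x List.∷ xs) with P? (f x)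
... | yes _ = cong suc (length-filter-map P? f xs)
... | no  _ = length-filter-map P? f xs

length-filter-cartesianProductWith-tabulate :
  {P : Pred Z 0ℓ} (P? : Decidable P) (f : X → Y → Z) (g : Fin k → X) (ys : List Y) →
  length (filter P? (cartesianProductWith f (List.tabulate g) ys)) ≡ ∑[ i < k ] length (filter (P? ∘ f (g i)) ys)
length-filter-cartesianProductWith-tabulate {k = zero}  P? f g ys = refl
length-filter-cartesianProductWith-tabulate {Z = Z} {k = suc k} P? f g ys = begin
  length (filter P? (row List.++ rest))
    ≡⟨ cong length (filter-++ P? row rest) ⟩
  length (filter P? row List.++ filter P? rest)
    ≡⟨ length-++ (filter P? row) ⟩
  length (filter P? row) + length (filter P? rest)
    ≡⟨ cong₂ _+_ (length-filter-map P? (f (g zero)) ys) (length-filter-cartesianProductWith-tabulate P? f (g ∘ suc) ys) ⟩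
  ∑[ i < suc k ] length (filter (P? ∘ f (g i)) ys) ∎
  where
  open ≡-Reasoning
  row rest : List Z
  row  = List.map (f (g zero)) ys
  rest = cartesianProductWith f (List.tabulate (g ∘ suc)) ys

length-filter-cartesianProduct :
  {P : Pred X 0ℓ} {Q : Pred Y 0ℓ} (P? : Decidable P) (Q? : Decidable Q) (xs : List X) (ys : List Y) →
  length (filter (P? ×? Q?) (cartesianProduct xs ys)) ≡ length (filter P? xs) * length (filter Q? ys)
length-filter-cartesianProduct P? Q? List.[]       ys = refl
length-filter-cartesianProduct {X = X} {Y = Y} P? Q? (x List.∷ xs) ys = begin
  length (filter (P? ×? Q?) (row List.++ rest))
    ≡⟨ cong length (filter-++ (P? ×? Q?) row rest) ⟩
  length (filter (P? ×? Q?) row List.++ filter (P? ×? Q?) rest)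
    ≡⟨ length-++ (filter (P? ×? Q?) row) ⟩
  length (filter (P? ×? Q?) row) + length (filter (P? ×? Q?) rest)
    ≡⟨ cong₂ _+_ (length-filter-map (P? ×? Q?) (x ,_) ys) (length-filter-cartesianProduct P? Q? xs ys) ⟩
  length (filter (λ y → (P? ×? Q?) (x , y)) ys) + length (filter P? xs) * length (filter Q? ys)
    ≡⟨ first-row ⟩
  length (filter P? (x List.∷ xs)) * length (filter Q? ys) ∎
  where
  open ≡-Reasoning
  row rest : List (X × Y)
  row  = List.map (x ,_) ys
  rest = cartesianProduct xs ys
  first-row : length (filter (λ y → (P? ×? Q?) (x , y)) ys) + length (filter P? xs) * length (filter Q? ys)
            ≡ length (filter P? (x List.∷ xs)) * length (filter Q? ys)
  first-row with P? x
  ... | yes Px = cong (_+ _) (cong length (filter-≐ _ Q? (proj₂ , (Px ,_)) ys))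
  ... | no ¬Px = cong (λ zs → length zs + _) (filter-none _ (All.universal (λ _ → ¬Px ∘ proj₁) ys))

Listing-Fin : (n : ℕ) → Listing (Fin n)
Listing-Fin n = record { elements = List.allFin n ; complete = ∈-allFin ; unique = Unique.allFin⁺ n }

Listing-Bool : Listing Bool
Listing-Bool = record
  { elements = true List.∷ false List.∷ List.[]
  ; complete = complete′
  ; unique   = ((λ ()) ∷ []) ∷ [] ∷ []
  }
  where
  complete′ : ∀ b → b ∈ₗ true List.∷ false List.∷ List.[]
  complete′ true  = here refl
  complete′ false = there (here refl)

_×ₗ_ : Listing X → Listing Y → Listing (X × Y)
EX ×ₗ EY = record
  { elements = cartesianProduct (elements EX) (elements EY)
  ; complete = λ (x , y) → ∈-cartesianProduct⁺ (complete EX x) (complete EY y)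
  ; unique   = Unique.cartesianProduct⁺ (unique EX) (unique EY)
  }

#-× : (EX : Listing X) (EY : Listing Y) {P : Pred X 0ℓ} {Q : Pred Y 0ℓ} (P? : Decidable P) (Q? : Decidable Q) →
      #[ EX ×ₗ EY ] (P? ×? Q?) ≡ #[ EX ] P? * #[ EY ] Q?
#-× EX EY P? Q? = length-filter-cartesianProduct P? Q? (elements EX) (elements EY)

vectors : List X → (k : ℕ) → List (Vec X k)
vectors xs zero    = [] List.∷ List.[]
vectors xs (suc k) = cartesianProductWith _∷_ xs (vectors xs k)

Listing-Vec : Listing X → (k : ℕ) → Listing (Vec X k)
Listing-Vec E k = record { elements = vectors (elements E) k ; complete = complete′ ; unique = unique′ k }
  where
  complete′ : ∀ {k} (v : Vec _ k) → v ∈ₗ vectors (elements E) k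
  complete′ []      = here refl
  complete′ (x ∷ v) = ∈-cartesianProductWith⁺ _∷_ (complete E x) (complete′ v)
  unique′ : ∀ k → Unique (vectors (elements E) k)
  unique′ zero    = [] ∷ []
  unique′ (suc k) = Unique.cartesianProductWith⁺ _∷_ ∷-injective (unique E) (unique′ k)

-- countVec sums over the first coordinate with a helper local to its definition.  Unifying against
-- a with-abstracted instance of it recovers that helper as a term; which instance is immaterial, as
-- the helper does not use the parameters of its enclosing clause.
private
  mutual
    countVec-sum : ∀ {l} → (Fin l → ℕ) → ℕ
    countVec-sum = _

    countVec-sum-pinned : ∀ m → countVec 1 m U? ≡ countVec-sum {m} (λ _ → 1)
    countVec-sum-pinned m with (λ (_ : Fin m) → 1)
    ... | f = refl

  countVec-sum≡∑ : (f : Fin k → ℕ) → countVec-sum f ≡ ∑[ i < k ] f i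
  countVec-sum≡∑ {zero}  f = refl
  countVec-sum≡∑ {suc k} f = cong (f zero +_) (countVec-sum≡∑ (f ∘ suc))

countVec≡# : ∀ k m {P : Pred (Vec (Fin m) k) 0ℓ} (P? : Decidable P) →
             countVec k m P? ≡ #[ Listing-Vec (Listing-Fin m) k ] P?
countVec≡# zero m P? with P? []
... | yes _ = refl
... | no  _ = refl
countVec≡# (suc k) m P? = begin
  countVec (suc k) m P?
    ≡⟨ countVec-sum≡∑ (λ x → countVec k m (P? ∘ (x ∷_))) ⟩
  ∑[ x < m ] countVec k m (P? ∘ (x ∷_))
    ≡⟨ sum-cong-≗ (λ x → countVec≡# k m (P? ∘ (x ∷_))) ⟩
  ∑[ x < m ] #[ Listing-Vec (Listing-Fin m) k ] (P? ∘ (x ∷_))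
    ≡⟨ length-filter-cartesianProductWith-tabulate P? _∷_ id _ ⟨
  #[ Listing-Vec (Listing-Fin m) (suc k) ] P? ∎
  where open ≡-Reasoning

-- Subsets of Fin k

module _ {f : Fin a → Fin b} (f-mono : ∀ {i j} → i < j → f i < f j) where

  strictMono⇒injective : ∀ {i j} → f i ≡ f j → i ≡ j
  strictMono⇒injective {i} {j} fi≡fj with <-cmp i j
  ... | tri< i<j _ _ = contradiction fi≡fj (λ e → <-irrefl e (f-mono i<j))
  ... | tri≈ _ i≡j _ = i≡j
  ... | tri> _ _ j<i = contradiction (sym fi≡fj) (λ e → <-irrefl e (f-mono j<i))

  strictMono⇒reflects< : ∀ {i j} → f i < f j → i < j
  strictMono⇒reflects< {i} {j} fi<fj with <-cmp i j
  ... | tri< i<j _ _  = i<j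
  ... | tri≈ _ refl _ = contradiction fi<fj (<-irrefl refl)
  ... | tri> _ _ j<i  = contradiction fi<fj (<-asym (f-mono j<i))

cast-injective : .(e : a ≡ b) {i j : Fin a} → Fin.cast e i ≡ Fin.cast e j → i ≡ j
cast-injective e {i} {j} eq = toℕ-injective (trans (sym (toℕ-cast e i)) (trans (cong toℕ eq) (toℕ-cast e j)))

select : (p : Subset k) → Fin ∣ p ∣ → Fin k
select (inside  ∷ p) zero    = zero
select (inside  ∷ p) (suc i) = suc (select p i)
select (outside ∷ p) i       = suc (select p i)

select-∈ : (p : Subset k) (i : Fin ∣ p ∣) → select p i ∈ p
select-∈ (inside  ∷ p) zero    = here
select-∈ (inside  ∷ p) (suc i) = there (select-∈ p i)
select-∈ (outside ∷ p) i       = there (select-∈ p i)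

select-mono : (p : Subset k) {i j : Fin ∣ p ∣} → i < j → select p i < select p j
select-mono (inside  ∷ p) {zero}  {suc j} _         = s≤s z≤n
select-mono (inside  ∷ p) {suc i} {suc j} (s≤s i<j) = s≤s (select-mono p i<j)
select-mono (outside ∷ p)                 i<j       = s≤s (select-mono p i<j)

select-injective : (p : Subset k) {i j : Fin ∣ p ∣} → select p i ≡ select p j → i ≡ j
select-injective p = strictMono⇒injective (select-mono p)

rank : {p : Subset k} {x : Fin k} → x ∈ p → Fin ∣ p ∣
rank {p = inside  ∷ p} here        = zero
rank {p = inside  ∷ p} (there x∈p) = suc (rank x∈p)
rank {p = outside ∷ p} (there x∈p) = rank x∈p

select-rank : {p : Subset k} {x : Fin k} (x∈p : x ∈ p) → select p (rank x∈p) ≡ x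
select-rank {p = inside  ∷ p} here        = refl
select-rank {p = inside  ∷ p} (there x∈p) = cong suc (select-rank x∈p)
select-rank {p = outside ∷ p} (there x∈p) = cong suc (select-rank x∈p)

rank-select : {p : Subset k} {x : Fin k} {i : Fin ∣ p ∣} (x∈p : x ∈ p) → select p i ≡ x → rank x∈p ≡ i
rank-select {p = p} x∈p refl = select-injective p (select-rank x∈p)

rank-cong : {p : Subset k} {x y : Fin k} (x∈p : x ∈ p) (y∈p : y ∈ p) → x ≡ y → rank x∈p ≡ rank y∈p
rank-cong x∈p y∈p x≡y = rank-select x∈p (trans (select-rank y∈p) (sym x≡y))

rank-injective : {p : Subset k} {x y : Fin k} (x∈p : x ∈ p) (y∈p : y ∈ p) → rank x∈p ≡ rank y∈p → x ≡ y
rank-injective {p = p} x∈p y∈p r≡r = trans (sym (select-rank x∈p)) (trans (cong (select p) r≡r) (select-rank y∈p))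

enumerate : (p : Subset k) → ∣ p ∣ ≡ K → Fin K → Fin k
enumerate p e i = select p (Fin.cast (sym e) i)

module _ (p : Subset k) (e : ∣ p ∣ ≡ K) where

  enumerate-∈ : ∀ i → enumerate p e i ∈ p
  enumerate-∈ i = select-∈ p (Fin.cast (sym e) i)

  enumerate-mono : ∀ {i j} → i < j → enumerate p e i < enumerate p e j
  enumerate-mono {i} {j} i<j = select-mono p (subst₂ ℕ._<_ (sym (toℕ-cast (sym e) i)) (sym (toℕ-cast (sym e) j)) i<j)

  enumerate-onto : ∀ {x} → x ∈ p → ∃ λ i → enumerate p e i ≡ x
  enumerate-onto x∈p =
    Fin.cast e (rank x∈p) , trans (cong (select p) (cast-involutive (sym e) e (rank x∈p))) (select-rank x∈p)

enumerate-cong : {p q : Subset k} → p ≡ q → (e : ∣ p ∣ ≡ K) (e′ : ∣ q ∣ ≡ K) →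
                 ∀ i → enumerate p e i ≡ enumerate q e′ i
enumerate-cong refl e e′ i = refl

∣∁∣≡ : (p : Subset k) → k ≡ a + b → ∣ p ∣ ≡ a → ∣ ∁ p ∣ ≡ b
∣∁∣≡ {a = a} {b} p refl ∣p∣≡a = trans (∣∁p∣≡n∸∣p∣ p) (trans (cong (a + b ∸_) ∣p∣≡a) (m+n∸m≡n a b))

preimage : Vec (Fin k) K → Subset k → Subset K
preimage M F = map (lookup F) M

module _ (M : Vec (Fin k) K) (F : Subset k) {x : Fin K} where

  ∈-preimage⁺ : lookup M x ∈ F → x ∈ preimage M F
  ∈-preimage⁺ Mx∈F = lookup⇒[]= x (preimage M F) (trans (lookup-map x (lookup F) M) ([]=⇒lookup Mx∈F))

  ∈-preimage⁻ : x ∈ preimage M F → lookup M x ∈ F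
  ∈-preimage⁻ x∈ = lookup⇒[]= (lookup M x) F (trans (sym (lookup-map x (lookup F) M)) ([]=⇒lookup x∈))

  ∈-∁-preimage⁺ : lookup M x ∈ ∁ F → x ∈ ∁ (preimage M F)
  ∈-∁-preimage⁺ Mx∈∁F = x∉p⇒x∈∁p (x∈∁p⇒x∉p Mx∈∁F ∘ ∈-preimage⁻)

  ∈-∁-preimage⁻ : x ∈ ∁ (preimage M F) → lookup M x ∈ ∁ F
  ∈-∁-preimage⁻ x∈∁ = x∉p⇒x∈∁p (x∈∁p⇒x∉p x∈∁ ∘ ∈-preimage⁺)

merge : (p : Subset k) → Vec X ∣ p ∣ → Vec X ∣ ∁ p ∣ → Vec X k
merge []            []       []       = []
merge (inside  ∷ p) (x ∷ xs) ys       = x ∷ merge p xs ys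
merge (outside ∷ p) xs       (y ∷ ys) = y ∷ merge p xs ys

lookup-merge-select : (p : Subset k) (xs : Vec X ∣ p ∣) (ys : Vec X ∣ ∁ p ∣) (i : Fin ∣ p ∣) →
                      lookup (merge p xs ys) (select p i) ≡ lookup xs i
lookup-merge-select (inside  ∷ p) (x ∷ xs) ys       zero    = refl
lookup-merge-select (inside  ∷ p) (x ∷ xs) ys       (suc i) = lookup-merge-select p xs ys i
lookup-merge-select (outside ∷ p) xs       (y ∷ ys) i       = lookup-merge-select p xs ys i

lookup-merge-select-∁ : (p : Subset k) (xs : Vec X ∣ p ∣) (ys : Vec X ∣ ∁ p ∣) (i : Fin ∣ ∁ p ∣) →
                        lookup (merge p xs ys) (select (∁ p) i) ≡ lookup ys i
lookup-merge-select-∁ (outside ∷ p) xs       (y ∷ ys) zero    = refl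
lookup-merge-select-∁ (outside ∷ p) xs       (y ∷ ys) (suc i) = lookup-merge-select-∁ p xs ys i
lookup-merge-select-∁ (inside  ∷ p) (x ∷ xs) ys       i       = lookup-merge-select-∁ p xs ys i

isInj₁ : X ⊎ Y → Bool
isInj₁ = [ const inside , const outside ]′

map-isInj₁-merge : (p : Subset k) (xs : Vec X ∣ p ∣) (ys : Vec Y ∣ ∁ p ∣) →
                   map isInj₁ (merge p (map inj₁ xs) (map inj₂ ys)) ≡ p
map-isInj₁-merge []            []       []       = refl
map-isInj₁-merge (inside  ∷ p) (x ∷ xs) ys       = cong (inside ∷_) (map-isInj₁-merge p xs ys)
map-isInj₁-merge (outside ∷ p) xs       (y ∷ ys) = cong (outside ∷_) (map-isInj₁-merge p xs ys)

-- Labellings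

Regular : ℕ → Vec (Fin k) K → Set
Regular r v = ∀ ℓ → count (_≟ ℓ) v ≡ r

count-tabulate : {P : Pred X 0ℓ} (P? : Decidable P) (f : Y → X) (g : Fin K → Y) →
                 count P? (tabulate (f ∘ g)) ≡ length (filter (P? ∘ f) (List.tabulate g))
count-tabulate {K = zero}  P? f g = refl
count-tabulate {K = suc K} P? f g with P? (f (g zero))
... | yes _ = cong suc (count-tabulate P? f (g ∘ suc))
... | no  _ = count-tabulate P? f (g ∘ suc)

count≡# : {P : Pred X 0ℓ} (P? : Decidable P) (v : Vec X K) → count P? v ≡ #[ Listing-Fin K ] (P? ∘ lookup v)
count≡# P? v = trans (cong (count P?) (sym (tabulate∘lookup v))) (count-tabulate P? (lookup v) id)

count-reindex : {P : Pred X 0ℓ} {Q : Pred Y 0ℓ} (P? : Decidable P) (Q? : Decidable Q) (v : Vec X K) (w : Vec Y k)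
  (ι : Fin K → Fin k) → (∀ {i j} → ι i ≡ ι j → i ≡ j) →
  (∀ i → P (lookup v i) ⇔ Q (lookup w (ι i))) → (∀ {p} → Q (lookup w p) → ∃ λ i → ι i ≡ p) →
  count P? v ≡ count Q? w
count-reindex {Q = Q} P? Q? v w ι ι-injective P⇔Q onto = begin
  count P? v                          ≡⟨ count≡# P? v ⟩
  #[ Listing-Fin _ ] (P? ∘ lookup v)  ≡⟨ ≤-antisym forth back ⟩
  #[ Listing-Fin _ ] (Q? ∘ lookup w)  ≡⟨ count≡# Q? w ⟨
  count Q? w                          ∎
  where
  open ≡-Reasoning
  forth : #[ Listing-Fin _ ] (P? ∘ lookup v) ≤ #[ Listing-Fin _ ] (Q? ∘ lookup w)
  forth = #-injection (Listing-Fin _) (Listing-Fin _) (P? ∘ lookup v) (Q? ∘ lookup w)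
            (λ i _ → ι i) (λ i → Equivalence.to (P⇔Q i)) (λ _ _ _ _ → ι-injective)
  back : #[ Listing-Fin _ ] (Q? ∘ lookup w) ≤ #[ Listing-Fin _ ] (P? ∘ lookup v)
  back = #-injection (Listing-Fin _) (Listing-Fin _) (Q? ∘ lookup w) (P? ∘ lookup v)
            (λ _ → proj₁ ∘ onto) (λ _ q → Equivalence.from (P⇔Q _) (subst (Q ∘ lookup w) (sym (proj₂ (onto q))) q))
            (λ _ _ q q′ ιi≡ιj → trans (sym (proj₂ (onto q))) (trans (cong ι ιi≡ιj) (proj₂ (onto q′))))

private
  ∑-zeros : (F : Subset k) → ∑[ j < k ] (if lookup F j then 0 else 0) ≡ 0
  ∑-zeros []            = refl
  ∑-zeros (inside  ∷ F) = ∑-zeros F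
  ∑-zeros (outside ∷ F) = ∑-zeros F

  indicator-sum : (F : Subset k) (x : Fin k) →
    ∑[ j < k ] (if lookup F j then (if does (x ≟ j) then 1 else 0) else 0) ≡ (if lookup F x then 1 else 0)
  indicator-sum (b ∷ F)       zero    = trans (cong ((if b then 1 else 0) +_) (∑-zeros F)) (+-identityʳ _)
  indicator-sum (inside  ∷ F) (suc x) = indicator-sum F x
  indicator-sum (outside ∷ F) (suc x) = indicator-sum F x

∣preimage∣≡∑ : (F : Subset k) (M : Vec (Fin k) K) →
               ∣ preimage M F ∣ ≡ ∑[ j < k ] (if lookup F j then count (_≟ j) M else 0)
∣preimage∣≡∑ F []      = sym (∑-zeros F)
∣preimage∣≡∑ F (x ∷ M) = begin
  ∣ lookup F x ∷ preimage M F ∣                  ≡⟨ head-step (lookup F x) ⟩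
  (if lookup F x then 1 else 0) + ∣ preimage M F ∣ ≡⟨ cong₂ _+_ (indicator-sum F x) (sym (∣preimage∣≡∑ F M)) ⟨
  ∑[ j < _ ] δ j + ∑[ j < _ ] c j                ≡⟨ ∑-distrib-+ δ c ⟨
  ∑[ j < _ ] (δ j + c j)                         ≡⟨ sum-cong-≗ δ+c≡c′ ⟩
  ∑[ j < _ ] (if lookup F j then count (_≟ j) (x ∷ M) else 0) ∎
  where
  open ≡-Reasoning
  δ c : Fin _ → ℕ
  δ j = if lookup F j then (if does (x ≟ j) then 1 else 0) else 0
  c j = if lookup F j then count (_≟ j) M else 0
  head-step : ∀ b → ∣ b ∷ preimage M F ∣ ≡ (if b then 1 else 0) + ∣ preimage M F ∣
  head-step inside  = refl
  head-step outside = refl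
  δ+c≡c′ : ∀ j → δ j + c j ≡ (if lookup F j then count (_≟ j) (x ∷ M) else 0)
  δ+c≡c′ j with lookup F j | does (x ≟ j)
  ... | inside  | true  = refl
  ... | inside  | false = refl
  ... | outside | _     = refl

∣preimage∣≡r*∣F∣ : ∀ {r} (F : Subset k) (M : Vec (Fin k) K) → Regular r M → ∣ preimage M F ∣ ≡ r * ∣ F ∣
∣preimage∣≡r*∣F∣ {r = r} F M M-regular =
  trans (∣preimage∣≡∑ F M) (trans (sum-cong-≗ counts-inside) (∑-inside F))
  where
  counts-inside : ∀ j → (if lookup F j then count (_≟ j) M else 0) ≡ (if lookup F j then r else 0)
  counts-inside j with lookup F j
  ... | inside  = M-regular j
  ... | outside = refl
  ∑-inside : ∀ {k} (F : Subset k) → ∑[ j < k ] (if lookup F j then r else 0) ≡ r * ∣ F ∣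
  ∑-inside []            = sym (*-zeroʳ r)
  ∑-inside (inside  ∷ F) = trans (cong (r +_) (∑-inside F)) (sym (*-suc r ∣ F ∣))
  ∑-inside (outside ∷ F) = ∑-inside F

count>0⇒∃ : {P : Pred X 0ℓ} (P? : Decidable P) (v : Vec X K) → 0 ℕ.< count P? v → ∃ λ i → P (lookup v i)
count>0⇒∃ P? (x ∷ v) 0<count with P? x
... | yes Px = zero , Px
... | no  _  with i , Pvi ← count>0⇒∃ P? v 0<count = suc i , Pvi

Regular⇒surjective : ∀ {r} .{{_ : NonZero r}} {v : Vec (Fin k) K} → Regular r v →
                     ∀ ℓ → ∃ λ i → lookup v i ≡ ℓ
Regular⇒surjective {r = r} {v = v} v-regular ℓ =
  count>0⇒∃ (_≟ ℓ) v (subst (0 ℕ.<_) (sym (v-regular ℓ)) (ℕ.>-nonZero⁻¹ r))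

-- Canonical labellings

Ker : (Fin K → X) → Rel (Fin K) 0ℓ
Ker f u v = f u ≡ f v

lookup-ext : {v w : Vec X K} → (∀ i → lookup v i ≡ lookup w i) → v ≡ w
lookup-ext {v = v} {w} v≗w = trans (sym (tabulate∘lookup v)) (trans (tabulate-cong v≗w) (tabulate∘lookup w))

IsCanonical : (Fin K → Fin k) → Set
IsCanonical {K} {k} s = (v : Fin K) (j : Fin k) → j < s v → ∃ λ u → u < v × s u ≡ j

canonical-unique : {M M′ : Vec (Fin k) K} → IsCanonical (lookup M) → IsCanonical (lookup M′) →
  Ker (lookup M) ⇒ Ker (lookup M′) → Ker (lookup M′) ⇒ Ker (lookup M) → M ≡ M′
canonical-unique {M = M} {M′} M-canonical M′-canonical M⇒M′ M′⇒M =
  lookup-ext (WF.All.wfRec <-wellFounded _ (λ v → lookup M v ≡ lookup M′ v) agree)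
  where
  agree : ∀ v → (∀ {u} → u < v → lookup M u ≡ lookup M′ u) → lookup M v ≡ lookup M′ v
  agree v ih with any? (λ u → (u <? v) ×-dec (lookup M u ≟ lookup M v))
  ... | yes (u , u<v , Mu≡Mv) = trans (sym Mu≡Mv) (trans (ih u<v) (M⇒M′ Mu≡Mv))
  ... | no  first with <-cmp (lookup M v) (lookup M′ v)
  ...   | tri≈ _ Mv≡M′v _ = Mv≡M′v
  ...   | tri< Mv<M′v _ _ with u , u<v , M′u≡Mv ← M′-canonical v (lookup M v) Mv<M′v =
    contradiction (u , u<v , trans (ih u<v) M′u≡Mv) first
  ...   | tri> _ _ M′v<Mv with u , u<v , Mu≡M′v ← M-canonical v (lookup M′ v) M′v<Mv =
    contradiction (u , u<v , M′⇒M (trans (sym (ih u<v)) Mu≡M′v)) first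

least : {P : Pred (Fin K) 0ℓ} → Decidable P → ∀ {v} → P v →
        ∃ λ u → P u × toℕ u ≤ toℕ v × (∀ {w} → w < u → ¬ P w)
least {K = suc K} P? Pv with P? zero
... | yes P0 = zero , P0 , z≤n , λ ()
least {K = suc K} P? {zero}  Pv | no ¬P0 = contradiction Pv ¬P0
least {K = suc K} {P} P? {suc v} Pv | no ¬P0 with u , Pu , u≤v , minimal ← least (P? ∘ suc) Pv =
  suc u , Pu , s≤s u≤v , minimal′
  where
  minimal′ : ∀ {w} → w < suc u → ¬ P w
  minimal′ {zero}  _         = ¬P0
  minimal′ {suc w} (s≤s w<u) = minimal w<u

module Standardisation (_≟ₓ_ : DecidableEquality X) {K : ℕ} (L : Fin K → X) where

  IsFirst : Pred (Fin K) 0ℓ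
  IsFirst u = ∀ w → w < u → L w ≢ L u

  isFirst? : Decidable IsFirst
  isFirst? u = all? λ w → (w <? u) →-dec ¬? (L w ≟ₓ L u)

  firsts : Subset K
  firsts = tabulate (does ∘ isFirst?)

  ∈-firsts⁺ : ∀ {u} → IsFirst u → u ∈ firsts
  ∈-firsts⁺ {u} u-first = lookup⇒[]= u firsts (trans (lookup∘tabulate _ u) (dec-true (isFirst? u) u-first))

  ∈-firsts⁻ : ∀ {u} → u ∈ firsts → IsFirst u
  ∈-firsts⁻ {u} u∈ = does≡true⇒ (isFirst? u) (trans (sym (lookup∘tabulate (does ∘ isFirst?) u)) ([]=⇒lookup u∈))
    where
    does≡true⇒ : (d : Dec (IsFirst u)) → does d ≡ true → IsFirst u
    does≡true⇒ (yes u-first) _ = u-first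

  firsts-injective : ∀ {u v} → IsFirst u → IsFirst v → L u ≡ L v → u ≡ v
  firsts-injective {u} {v} u-first v-first Lu≡Lv with <-cmp u v
  ... | tri< u<v _ _ = contradiction Lu≡Lv (v-first u u<v)
  ... | tri≈ _ u≡v _ = u≡v
  ... | tri> _ _ v<u = contradiction (sym Lu≡Lv) (u-first v v<u)

  private
    first-occurrence : ∀ v → ∃ λ u → L u ≡ L v × toℕ u ≤ toℕ v × (∀ {w} → w < u → L w ≢ L v)
    first-occurrence v = least (λ u → L u ≟ₓ L v) refl

  first : Fin K → Fin K
  first v = proj₁ (first-occurrence v)

  L-first : ∀ v → L (first v) ≡ L v
  L-first v = proj₁ (proj₂ (first-occurrence v))

  first≤ : ∀ v → toℕ (first v) ≤ toℕ v
  first≤ v = proj₁ (proj₂ (proj₂ (first-occurrence v)))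

  first-isFirst : ∀ v → IsFirst (first v)
  first-isFirst v w w<first Lw≡ = proj₂ (proj₂ (proj₂ (first-occurrence v))) w<first (trans Lw≡ (L-first v))

  first-cong : ∀ {u v} → L u ≡ L v → first u ≡ first v
  first-cong {u} {v} Lu≡Lv =
    firsts-injective (first-isFirst u) (first-isFirst v) (trans (L-first u) (trans Lu≡Lv (sym (L-first v))))

  first-∈ : ∀ v → first v ∈ firsts
  first-∈ v = ∈-firsts⁺ (first-isFirst v)

  distinct : ℕ
  distinct = ∣ firsts ∣

  standardise : Fin K → Fin distinct
  standardise v = rank (first-∈ v)

  standardise-select : ∀ j → standardise (select firsts j) ≡ j
  standardise-select j =
    rank-select _ (sym (firsts-injective (first-isFirst w) (∈-firsts⁻ (select-∈ firsts j)) (L-first w)))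
    where
    w : Fin K
    w = select firsts j

  Ker-standardise⁺ : Ker L ⇒ Ker standardise
  Ker-standardise⁺ {u} {v} Lu≡Lv = rank-cong (first-∈ u) (first-∈ v) (first-cong Lu≡Lv)

  Ker-standardise⁻ : Ker standardise ⇒ Ker L
  Ker-standardise⁻ {u} {v} su≡sv =
    trans (sym (L-first u)) (trans (cong L (rank-injective (first-∈ u) (first-∈ v) su≡sv)) (L-first v))

  standardise-canonical : IsCanonical standardise
  standardise-canonical v j j<sv = select firsts j , <-≤-trans w<first (first≤ v) , standardise-select j
    where
    w<first : select firsts j < first v
    w<first = subst (select firsts j <_) (select-rank _) (select-mono firsts j<sv)

canonical-tabulate-cast : (e : a ≡ b) {s : Fin K → Fin a} → IsCanonical s →
                          IsCanonical (lookup (tabulate (Fin.cast e ∘ s)))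
canonical-tabulate-cast e {s} s-canonical v j j<sv = conclude (s-canonical v (Fin.cast (sym e) j) j′<sv)
  where
  j′<sv : Fin.cast (sym e) j < s v
  j′<sv = subst₂ ℕ._<_ (sym (toℕ-cast (sym e) j)) (trans (cong toℕ (lookup∘tabulate _ v)) (toℕ-cast e (s v))) j<sv
  conclude : (∃ λ u → u < v × s u ≡ Fin.cast (sym e) j) →
             ∃ λ u → u < v × lookup (tabulate (Fin.cast e ∘ s)) u ≡ j
  conclude (u , u<v , su≡j′) =
    u , u<v , trans (lookup∘tabulate _ u) (trans (cong (Fin.cast e) su≡j′) (cast-involutive e (sym e) j))

surjective∧Ker⇒≤ : (f : Fin K → Fin a) (g : Fin K → Fin b) → (∀ j → ∃ λ u → f u ≡ j) → Ker g ⇒ Ker f → a ≤ b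
surjective∧Ker⇒≤ f g f-onto g⇒f = injective⇒≤ {f = g ∘ proj₁ ∘ f-onto} λ {i} {j} g≡ →
  trans (sym (proj₂ (f-onto i))) (trans (g⇒f g≡) (proj₂ (f-onto j)))

module Restriction {k N l K : ℕ} (M : Vec (Fin k) N) (G : Subset k) (∣G∣≡l : ∣ G ∣ ≡ l)
                   (U : Subset N) (∣U∣≡K : ∣ U ∣ ≡ K)
                   (U⇒G : ∀ {p} → p ∈ U → lookup M p ∈ G) (G⇒U : ∀ {p} → lookup M p ∈ G → p ∈ U) where

  ι : Fin K → Fin N
  ι = enumerate U ∣U∣≡K

  ι-mono : ∀ {i j} → i < j → ι i < ι j
  ι-mono = enumerate-mono U ∣U∣≡K

  ι-onto : ∀ {p} → lookup M p ∈ G → ∃ λ i → ι i ≡ p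
  ι-onto = enumerate-onto U ∣U∣≡K ∘ G⇒U

  ι-∈ : ∀ i → lookup M (ι i) ∈ G
  ι-∈ = U⇒G ∘ enumerate-∈ U ∣U∣≡K

  label : Fin K → Fin ∣ G ∣
  label i = rank (ι-∈ i)

  restriction : Vec (Fin l) K
  restriction = tabulate (Fin.cast ∣G∣≡l ∘ label)

  lookup-restriction : ∀ i → lookup restriction i ≡ Fin.cast ∣G∣≡l (label i)
  lookup-restriction = lookup∘tabulate (Fin.cast ∣G∣≡l ∘ label)

  Ker-restriction⁺ : Ker (lookup M ∘ ι) ⇒ Ker (lookup restriction)
  Ker-restriction⁺ {i} {j} Mι≡ = trans (lookup-restriction i)
    (trans (cong (Fin.cast ∣G∣≡l) (rank-cong (ι-∈ i) (ι-∈ j) Mι≡)) (sym (lookup-restriction j)))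

  Ker-restriction⁻ : Ker (lookup restriction) ⇒ Ker (lookup M ∘ ι)
  Ker-restriction⁻ {i} {j} R≡ = rank-injective (ι-∈ i) (ι-∈ j)
    (cast-injective ∣G∣≡l (trans (sym (lookup-restriction i)) (trans R≡ (lookup-restriction j))))

  -- Ranks in G preserve the order of labels, so first occurrences stay in order.
  label-canonical : IsCanonical (lookup M) → IsCanonical label
  label-canonical M-canonical v j j<label = conclude (M-canonical (ι v) (select G j) ℓ<Mιv)
    where
    ℓ<Mιv : select G j < lookup M (ι v)
    ℓ<Mιv = subst (select G j <_) (select-rank (ι-∈ v)) (select-mono G j<label)
    conclude : (∃ λ p → p < ι v × lookup M p ≡ select G j) → ∃ λ u → u < v × label u ≡ j
    conclude (p , p<ιv , Mp≡ℓ) with u , refl ← ι-onto (subst (_∈ G) (sym Mp≡ℓ) (select-∈ G j)) =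
      u , strictMono⇒reflects< ι-mono p<ιv , rank-select (ι-∈ u) (sym Mp≡ℓ)

  restriction-canonical : IsCanonical (lookup M) → IsCanonical (lookup restriction)
  restriction-canonical = canonical-tabulate-cast ∣G∣≡l ∘ label-canonical

  restriction-regular : ∀ {r} → Regular r M → Regular r restriction
  restriction-regular M-regular j = trans (count-reindex (_≟ j) (_≟ ℓ) restriction M ι
    (strictMono⇒injective ι-mono) R≡j⇔Mι≡ℓ (λ Mp≡ℓ → ι-onto (subst (_∈ G) (sym Mp≡ℓ) (select-∈ G j′))))
    (M-regular ℓ)
    where
    j′ : Fin ∣ G ∣
    j′ = Fin.cast (sym ∣G∣≡l) j
    ℓ : Fin k
    ℓ = select G j′
    R≡j⇔Mι≡ℓ : ∀ i → lookup restriction i ≡ j ⇔ lookup M (ι i) ≡ ℓ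
    R≡j⇔Mι≡ℓ i = mk⇔
      (λ R≡j → trans (sym (select-rank (ι-∈ i))) (cong (select G) (cast-injective ∣G∣≡l
        (trans (sym (lookup-restriction i)) (trans R≡j (sym (cast-involutive ∣G∣≡l (sym ∣G∣≡l) j)))))))
      (λ Mι≡ℓ → trans (lookup-restriction i)
        (trans (cong (Fin.cast ∣G∣≡l) (rank-select (ι-∈ i) (sym Mι≡ℓ))) (cast-involutive ∣G∣≡l (sym ∣G∣≡l) j)))

Contains-refl : ∀ {r m} (H : Vec (Fin m) (r * m)) → Contains r m m H H
Contains-refl H = tabulate id , (λ u v → subst₂ _<_ (sym (lookup∘tabulate id u)) (sym (lookup∘tabulate id v))) ,
  λ u v → subst₂ (λ a b → lookup H a ≡ lookup H b) (sym (lookup∘tabulate id u)) (sym (lookup∘tabulate id v)) ,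
          subst₂ (λ a b → lookup H a ≡ lookup H b) (lookup∘tabulate id u) (lookup∘tabulate id v)

Contains-along : ∀ {r m l n} {H : Vec (Fin m) (r * m)} {R : Vec (Fin l) (r * l)} {M : Vec (Fin n) (r * n)}
  (ι : Fin (r * l) → Fin (r * n)) → (∀ {i j} → i < j → ι i < ι j) →
  Ker (lookup R) ⇒ Ker (lookup M ∘ ι) → Ker (lookup M ∘ ι) ⇒ Ker (lookup R) →
  Contains r m l H R → Contains r m n H M
Contains-along {r} {m} {l} {n} {H} {R} {M} ι ι-mono R⇒M M⇒R (ψ , ψ-mono , ψ-Ker) = φ , φ-mono , φ-Ker
  where
  φ : Vec (Fin (r * n)) (r * m)
  φ = tabulate (ι ∘ lookup ψ)
  lookup-φ : ∀ u → lookup φ u ≡ ι (lookup ψ u)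
  lookup-φ = lookup∘tabulate (ι ∘ lookup ψ)
  φ-mono : ∀ u v → u < v → lookup φ u < lookup φ v
  φ-mono u v u<v = subst₂ _<_ (sym (lookup-φ u)) (sym (lookup-φ v)) (ι-mono (ψ-mono u v u<v))
  M-at : ∀ {u v} → lookup M (lookup φ u) ≡ lookup M (lookup φ v) ⇔
                   lookup M (ι (lookup ψ u)) ≡ lookup M (ι (lookup ψ v))
  M-at {u} {v} = mk⇔ (subst₂ (λ a b → lookup M a ≡ lookup M b) (lookup-φ u) (lookup-φ v))
                     (subst₂ (λ a b → lookup M a ≡ lookup M b) (sym (lookup-φ u)) (sym (lookup-φ v)))
  φ-Ker : ∀ u v → (lookup H u ≡ lookup H v → lookup M (lookup φ u) ≡ lookup M (lookup φ v))
                × (lookup M (lookup φ u) ≡ lookup M (lookup φ v) → lookup H u ≡ lookup H v)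
  φ-Ker u v = Equivalence.from M-at ∘ R⇒M ∘ proj₁ (ψ-Ker u v) , proj₂ (ψ-Ker u v) ∘ M⇒R ∘ Equivalence.to M-at

-- Splitting and merging matchings

module Splitting (r : ℕ) {{_ : NonZero r}} (m n′ : ℕ) where

  n : ℕ
  n = m + n′

  Triple : Set
  Triple = Subset (r * n) × (Vec (Fin m) (r * m) × Vec (Fin n′) (r * n′))

  module Split (M : Vec (Fin n) (r * n)) (F : Subset n) (M-regular : Regular r M) (∣F∣≡m : ∣ F ∣ ≡ m) where

    U : Subset (r * n)
    U = preimage M F

    ∣U∣≡ : ∣ U ∣ ≡ r * m
    ∣U∣≡ = trans (∣preimage∣≡r*∣F∣ F M M-regular) (cong (r *_) ∣F∣≡m)

    ∣∁U∣≡ : ∣ ∁ U ∣ ≡ r * n′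
    ∣∁U∣≡ = ∣∁∣≡ U (*-distribˡ-+ r m n′) ∣U∣≡

    module Inside  = Restriction M F ∣F∣≡m U ∣U∣≡ (∈-preimage⁻ M F) (∈-preimage⁺ M F)
    module Outside = Restriction M (∁ F) (∣∁∣≡ F refl ∣F∣≡m) (∁ U) ∣∁U∣≡
                                 (∈-∁-preimage⁻ M F) (∈-∁-preimage⁺ M F)

  split : (M : Vec (Fin n) (r * n)) (F : Subset n) → Regular r M → ∣ F ∣ ≡ m → Triple
  split M F M-regular ∣F∣≡m = U , Inside.restriction , Outside.restriction
    where open Split M F M-regular ∣F∣≡m

  split-cong : ∀ {M M′ F F′} → M ≡ M′ → F ≡ F′ → ∀ c c′ e e′ → split M F c e ≡ split M′ F′ c′ e′
  split-cong refl refl c c′ e e′ = refl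

  module _ (M : Vec (Fin n) (r * n)) (F : Subset n) (M-matching : IsMatching r n M) (∣F∣≡m : ∣ F ∣ ≡ m)
           where
    open Split M F (proj₁ M-matching) ∣F∣≡m

    split-matchings : IsMatching r m Inside.restriction × IsMatching r n′ Outside.restriction
    split-matchings =
      (Inside.restriction-regular (proj₁ M-matching) , Inside.restriction-canonical (proj₂ M-matching)) ,
      (Outside.restriction-regular (proj₁ M-matching) , Outside.restriction-canonical (proj₂ M-matching))

    split-avoids : ∀ H → ¬ Contains r m n H M →
                   ¬ Contains r m m H Inside.restriction × ¬ Contains r m n′ H Outside.restriction
    split-avoids H M-avoids =
      M-avoids ∘ Contains-along {r = r} {H = H} {R = Inside.restriction} {M = M}
                   Inside.ι Inside.ι-mono Inside.Ker-restriction⁻ Inside.Ker-restriction⁺ ,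
      M-avoids ∘ Contains-along {r = r} {H = H} {R = Outside.restriction} {M = M}
                   Outside.ι Outside.ι-mono Outside.Ker-restriction⁻ Outside.Ker-restriction⁺

  private
    Ker-transfer : ∀ {K} {Z : Set} (M M′ : Vec (Fin n) (r * n)) (ι ι′ : Fin K → Fin (r * n))
      {R R′ : Vec Z K} →
      ι ≗ ι′ → R ≡ R′ → Ker (lookup M ∘ ι) ⇒ Ker (lookup R) → Ker (lookup R′) ⇒ Ker (lookup M′ ∘ ι′) →
      ∀ {p q} → (∃ λ u → ι u ≡ p) → (∃ λ v → ι v ≡ q) → lookup M p ≡ lookup M q → lookup M′ p ≡ lookup M′ q
    Ker-transfer M M′ ι ι′ ι≗ι′ refl M⇒R R⇒M′ (u , refl) (v , refl) Mp≡Mq =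
      subst₂ (λ a b → lookup M′ a ≡ lookup M′ b) (sym (ι≗ι′ u)) (sym (ι≗ι′ v)) (R⇒M′ (M⇒R Mp≡Mq))

  split-Ker : ∀ M M′ F F′ c c′ e e′ → split M F c e ≡ split M′ F′ c′ e′ → Ker (lookup M) ⇒ Ker (lookup M′)
  split-Ker M M′ F F′ c c′ e e′ same {p} {q} Mp≡Mq = by-side (lookup M p ∈? F)
    where
    module S  = Split M F c e
    module S′ = Split M′ F′ c′ e′
    U≡U′ : S.U ≡ S′.U
    U≡U′ = cong proj₁ same
    by-side : Dec (lookup M p ∈ F) → lookup M′ p ≡ lookup M′ q
    by-side (yes Mp∈F) =
      Ker-transfer M M′ S.Inside.ι S′.Inside.ι (enumerate-cong U≡U′ S.∣U∣≡ S′.∣U∣≡) (cong (proj₁ ∘ proj₂) same)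
        S.Inside.Ker-restriction⁺ S′.Inside.Ker-restriction⁻
        (S.Inside.ι-onto Mp∈F) (S.Inside.ι-onto (subst (_∈ F) Mp≡Mq Mp∈F)) Mp≡Mq
    by-side (no Mp∉F) =
      Ker-transfer M M′ S.Outside.ι S′.Outside.ι (enumerate-cong (cong ∁ U≡U′) S.∣∁U∣≡ S′.∣∁U∣≡)
        (cong (proj₂ ∘ proj₂) same)
        S.Outside.Ker-restriction⁺ S′.Outside.Ker-restriction⁻
        (S.Outside.ι-onto (x∉p⇒x∈∁p Mp∉F)) (S.Outside.ι-onto (x∉p⇒x∈∁p (Mp∉F ∘ subst (_∈ F) (sym Mp≡Mq))))
        Mp≡Mq

  split-injective : ∀ M M′ F F′ (M-matching : IsMatching r n M) (M′-matching : IsMatching r n M′) e e′ →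
    split M F (proj₁ M-matching) e ≡ split M′ F′ (proj₁ M′-matching) e′ → M ≡ M′ × F ≡ F′
  split-injective M M′ F F′ (c , M-canonical) (c′ , M′-canonical) e e′ same = M≡M′ , lookup-ext F≗F′
    where
    M≡M′ : M ≡ M′
    M≡M′ = canonical-unique M-canonical M′-canonical
      (split-Ker M M′ F F′ c c′ e e′ same) (split-Ker M′ M F′ F c′ c e′ e (sym same))
    F≗F′ : ∀ ℓ → lookup F ℓ ≡ lookup F′ ℓ
    F≗F′ ℓ = let p , Mp≡ℓ = Regular⇒surjective {v = M} c ℓ in begin
      lookup F ℓ                 ≡⟨ cong (lookup F) Mp≡ℓ ⟨
      lookup F (lookup M p)      ≡⟨ lookup-map p (lookup F) M ⟨
      lookup (preimage M F) p    ≡⟨ cong (λ U → lookup U p) (cong proj₁ same) ⟩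
      lookup (preimage M′ F′) p  ≡⟨ lookup-map p (lookup F′) M′ ⟩
      lookup F′ (lookup M′ p)    ≡⟨ cong (λ M → lookup F′ (lookup M p)) M≡M′ ⟨
      lookup F′ (lookup M p)     ≡⟨ cong (lookup F′) Mp≡ℓ ⟩
      lookup F′ ℓ                ∎
      where open ≡-Reasoning

  _≟ₗ_ : DecidableEquality (Fin m ⊎ Fin n′)
  _≟ₗ_ = Sum.≡-dec _≟_ _≟_

  module Merge (U : Subset (r * n)) (M₁ : Vec (Fin m) (r * m)) (M₂ : Vec (Fin n′) (r * n′))
               (∣U∣≡ : ∣ U ∣ ≡ r * m) (M₁-matching : IsMatching r m M₁) (M₂-matching : IsMatching r n′ M₂) where

    ∣∁U∣≡ : ∣ ∁ U ∣ ≡ r * n′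
    ∣∁U∣≡ = ∣∁∣≡ U (*-distribˡ-+ r m n′) ∣U∣≡

    ι₁ : Fin (r * m) → Fin (r * n)
    ι₁ = enumerate U ∣U∣≡

    ι₂ : Fin (r * n′) → Fin (r * n)
    ι₂ = enumerate (∁ U) ∣∁U∣≡

    labels : Vec (Fin m ⊎ Fin n′) (r * n)
    labels = merge U (map inj₁ (Vec.cast (sym ∣U∣≡) M₁)) (map inj₂ (Vec.cast (sym ∣∁U∣≡) M₂))

    L : Fin (r * n) → Fin m ⊎ Fin n′
    L = lookup labels

    L-ι₁ : ∀ i → L (ι₁ i) ≡ inj₁ (lookup M₁ i)
    L-ι₁ i = trans (lookup-merge-select U _ _ i′) (trans (lookup-map i′ inj₁ (Vec.cast (sym ∣U∣≡) M₁))
                                                          (cong inj₁ (lookup-cast (sym ∣U∣≡) M₁ i)))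
      where
      i′ : Fin ∣ U ∣
      i′ = Fin.cast (sym ∣U∣≡) i

    L-ι₂ : ∀ i → L (ι₂ i) ≡ inj₂ (lookup M₂ i)
    L-ι₂ i = trans (lookup-merge-select-∁ U _ _ i′) (trans (lookup-map i′ inj₂ (Vec.cast (sym ∣∁U∣≡) M₂))
                                                            (cong inj₂ (lookup-cast (sym ∣∁U∣≡) M₂ i)))
      where
      i′ : Fin ∣ ∁ U ∣
      i′ = Fin.cast (sym ∣∁U∣≡) i

    isInj₁-L : ∀ p → isInj₁ (L p) ≡ lookup U p
    isInj₁-L p = trans (sym (lookup-map p isInj₁ labels)) (cong (λ V → lookup V p) (map-isInj₁-merge U _ _))

    L-inj₁⇒∈ : ∀ {p y} → L p ≡ inj₁ y → p ∈ U
    L-inj₁⇒∈ {p} Lp≡ = lookup⇒[]= p U (trans (sym (isInj₁-L p)) (cong isInj₁ Lp≡))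

    L-inj₂⇒∈∁ : ∀ {p z} → L p ≡ inj₂ z → p ∈ ∁ U
    L-inj₂⇒∈∁ {p} Lp≡ = x∉p⇒x∈∁p λ p∈U →
      inside≢outside (trans (sym ([]=⇒lookup p∈U)) (trans (sym (isInj₁-L p)) (cong isInj₁ Lp≡)))
      where
      inside≢outside : inside ≢ outside
      inside≢outside ()

    labels-regular : ∀ s → count (_≟ₗ s) labels ≡ r
    labels-regular (inj₁ y) = trans (sym (count-reindex (_≟ y) (_≟ₗ inj₁ y) M₁ labels ι₁
      (strictMono⇒injective (enumerate-mono U ∣U∣≡))
      (λ i → mk⇔ (trans (L-ι₁ i) ∘ cong inj₁) (λ Lι≡ → Sum.inj₁-injective (trans (sym (L-ι₁ i)) Lι≡)))
      (enumerate-onto U ∣U∣≡ ∘ L-inj₁⇒∈))) (proj₁ M₁-matching y)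
    labels-regular (inj₂ z) = trans (sym (count-reindex (_≟ z) (_≟ₗ inj₂ z) M₂ labels ι₂
      (strictMono⇒injective (enumerate-mono (∁ U) ∣∁U∣≡))
      (λ i → mk⇔ (trans (L-ι₂ i) ∘ cong inj₂) (λ Lι≡ → Sum.inj₂-injective (trans (sym (L-ι₂ i)) Lι≡)))
      (enumerate-onto (∁ U) ∣∁U∣≡ ∘ L-inj₂⇒∈∁))) (proj₁ M₂-matching z)

    L-onto : ∀ s → ∃ λ p → L p ≡ s
    L-onto (inj₁ y) with i , refl ← Regular⇒surjective {v = M₁} (proj₁ M₁-matching) y = ι₁ i , L-ι₁ i
    L-onto (inj₂ z) with i , refl ← Regular⇒surjective {v = M₂} (proj₁ M₂-matching) z = ι₂ i , L-ι₂ i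

    open Standardisation _≟ₗ_ L

    distinct≡n : distinct ≡ n
    distinct≡n = ≤-antisym
      (surjective∧Ker⇒≤ standardise g (λ j → select firsts j , standardise-select j)
                        (Ker-standardise⁺ ∘ join-injective))
      (surjective∧Ker⇒≤ g standardise g-onto (cong (join m n′) ∘ Ker-standardise⁻))
      where
      g : Fin (r * n) → Fin n
      g = join m n′ ∘ L
      join-injective : ∀ {s t} → join m n′ s ≡ join m n′ t → s ≡ t
      join-injective {s} {t} e = trans (sym (splitAt-join m n′ s)) (trans (cong (splitAt m) e) (splitAt-join m n′ t))
      g-onto : ∀ j → ∃ λ p → g p ≡ j
      g-onto j with p , Lp≡ ← L-onto (splitAt m j) = p , trans (cong (join m n′) Lp≡) (join-splitAt m n′ j)

    merged : Vec (Fin n) (r * n)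
    merged = tabulate (Fin.cast distinct≡n ∘ standardise)

    lookup-merged : ∀ p → lookup merged p ≡ Fin.cast distinct≡n (standardise p)
    lookup-merged = lookup∘tabulate (Fin.cast distinct≡n ∘ standardise)

    Ker-merged⁺ : Ker L ⇒ Ker (lookup merged)
    Ker-merged⁺ {p} {q} Lp≡Lq =
      trans (lookup-merged p) (trans (cong (Fin.cast distinct≡n) (Ker-standardise⁺ Lp≡Lq)) (sym (lookup-merged q)))

    Ker-merged⁻ : Ker (lookup merged) ⇒ Ker L
    Ker-merged⁻ {p} {q} merged≡ =
      Ker-standardise⁻ (cast-injective distinct≡n (trans (sym (lookup-merged p)) (trans merged≡ (lookup-merged q))))

    representative : Fin n → Fin (r * n)
    representative j = select firsts (Fin.cast (sym distinct≡n) j)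

    merged-representative : ∀ j → lookup merged (representative j) ≡ j
    merged-representative j = trans (lookup-merged _)
      (trans (cong (Fin.cast distinct≡n) (standardise-select _)) (cast-involutive distinct≡n (sym distinct≡n) j))

    merged-matching : IsMatching r n merged
    merged-matching = merged-regular , canonical-tabulate-cast distinct≡n standardise-canonical
      where
      merged-regular : Regular r merged
      merged-regular j = trans (count-reindex (_≟ j) (_≟ₗ L (representative j)) merged labels id id
        (λ p → mk⇔ (λ merged≡j → Ker-merged⁻ (trans merged≡j (sym (merged-representative j))))
                   (λ Lp≡ → trans (Ker-merged⁺ Lp≡) (merged-representative j)))
        (λ {p} _ → p , refl)) (labels-regular (L (representative j)))

    edges₁ : Subset n
    edges₁ = tabulate (isInj₁ ∘ L ∘ representative)

    preimage-edges₁ : preimage merged edges₁ ≡ U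
    preimage-edges₁ = lookup-ext λ p → begin
      lookup (preimage merged edges₁) p              ≡⟨ lookup-map p (lookup edges₁) merged ⟩
      lookup edges₁ (lookup merged p)                ≡⟨ lookup∘tabulate (isInj₁ ∘ L ∘ representative) _ ⟩
      isInj₁ (L (representative (lookup merged p)))  ≡⟨ cong isInj₁ (Ker-merged⁻ (merged-representative _)) ⟩
      isInj₁ (L p)                                   ≡⟨ isInj₁-L p ⟩
      lookup U p                                     ∎
      where open ≡-Reasoning

    ∣edges₁∣≡m : ∣ edges₁ ∣ ≡ m
    ∣edges₁∣≡m = *-cancelˡ-≡ ∣ edges₁ ∣ m r (begin
      r * ∣ edges₁ ∣                  ≡⟨ ∣preimage∣≡r*∣F∣ edges₁ merged (proj₁ merged-matching) ⟨
      ∣ preimage merged edges₁ ∣      ≡⟨ cong ∣_∣ preimage-edges₁ ⟩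
      ∣ U ∣                           ≡⟨ ∣U∣≡ ⟩
      r * m                           ∎)
      where open ≡-Reasoning

    private
      module S = Split merged edges₁ (proj₁ merged-matching) ∣edges₁∣≡m

      restriction≡side : ∀ {l} (Mₛ R : Vec (Fin l) (r * l)) (inj : Fin l → Fin m ⊎ Fin n′) →
        (∀ {x y} → inj x ≡ inj y → x ≡ y) → (ι ι′ : Fin (r * l) → Fin (r * n)) → ι′ ≗ ι →
        (∀ i → L (ι i) ≡ inj (lookup Mₛ i)) → IsCanonical (lookup R) → IsCanonical (lookup Mₛ) →
        Ker (lookup R) ⇒ Ker (lookup merged ∘ ι′) → Ker (lookup merged ∘ ι′) ⇒ Ker (lookup R) → R ≡ Mₛ
      restriction≡side Mₛ R inj inj-injective ι ι′ ι′≗ι L∘ι R-canonical Mₛ-canonical R⇒ ⇒R =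
        canonical-unique R-canonical Mₛ-canonical
          (λ {u} {v} R≡ → inj-injective
             (trans (sym (L∘ι u)) (trans (Equivalence.to L-at (Ker-merged⁻ (R⇒ R≡))) (L∘ι v))))
          (λ {u} {v} Mₛ≡ → ⇒R (Ker-merged⁺
             (Equivalence.from L-at (trans (L∘ι u) (trans (cong inj Mₛ≡) (sym (L∘ι v)))))))
        where
        L-at : ∀ {u v} → L (ι′ u) ≡ L (ι′ v) ⇔ L (ι u) ≡ L (ι v)
        L-at {u} {v} = mk⇔ (subst₂ (λ a b → L a ≡ L b) (ι′≗ι u) (ι′≗ι v))
                           (subst₂ (λ a b → L a ≡ L b) (sym (ι′≗ι u)) (sym (ι′≗ι v)))

    split-merge : split merged edges₁ (proj₁ merged-matching) ∣edges₁∣≡m ≡ (U , M₁ , M₂)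
    split-merge = cong₂ _,_ preimage-edges₁ (cong₂ _,_
      (restriction≡side M₁ S.Inside.restriction inj₁ Sum.inj₁-injective ι₁ S.Inside.ι
         (enumerate-cong preimage-edges₁ S.∣U∣≡ ∣U∣≡) L-ι₁
         (S.Inside.restriction-canonical (proj₂ merged-matching)) (proj₂ M₁-matching)
         S.Inside.Ker-restriction⁻ S.Inside.Ker-restriction⁺)
      (restriction≡side M₂ S.Outside.restriction inj₂ Sum.inj₂-injective ι₂ S.Outside.ι
         (enumerate-cong (cong ∁ preimage-edges₁) S.∣∁U∣≡ ∣∁U∣≡) L-ι₂
         (S.Outside.restriction-canonical (proj₂ merged-matching)) (proj₂ M₂-matching)
         S.Outside.Ker-restriction⁻ S.Outside.Ker-restriction⁺))

-- Arithmetic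

j*x^j≤x*[1+x]^j : ∀ x j → j * x ^ j ≤ x * suc x ^ j
j*x^j≤x*[1+x]^j x zero    = z≤n
j*x^j≤x*[1+x]^j x (suc j) = begin
  suc j * (x * x ^ j)                 ≡⟨ expand x j (x ^ j) ⟩
  x * x ^ j + x * (j * x ^ j)         ≤⟨ +-mono-≤ (*-monoʳ-≤ x (^-monoˡ-≤ j (n≤1+n x)))
                                                  (*-monoʳ-≤ x (j*x^j≤x*[1+x]^j x j)) ⟩
  x * suc x ^ j + x * (x * suc x ^ j) ≡⟨ factor x (suc x ^ j) ⟩
  x * suc x ^ suc j                   ∎
  where
  open ≤-Reasoning
  expand : ∀ x j X → suc j * (x * X) ≡ x * X + x * (j * X)
  expand = solve-∀
  factor : ∀ x Y → x * Y + x * (x * Y) ≡ x * (Y + x * Y)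
  factor = solve-∀

pow-gap : ∀ {x y} → x ℕ.< y → ∀ k → ∃ λ j → k * x ^ j ≤ y ^ j
pow-gap {zero}  {y}     _     k = 1 , subst (_≤ y ^ 1) (sym (*-zeroʳ k)) z≤n
pow-gap {suc x} {y} 1+x<y k = j , (begin
  k * suc x ^ j   ≤⟨ *-cancelˡ-≤ (suc x) (subst (_≤ suc x * suc (suc x) ^ j) (swap k (suc x) (suc x ^ j))
                                                (j*x^j≤x*[1+x]^j (suc x) j)) ⟩
  suc (suc x) ^ j ≤⟨ ^-monoˡ-≤ j 1+x<y ⟩
  y ^ j           ∎)
  where
  open ≤-Reasoning
  j : ℕ
  j = k * suc x
  swap : ∀ k x X → k * x * X ≡ x * (k * X)
  swap = solve-∀

ratio-step : ∀ {a a′ t t′ s p c c′ x y} → 0 ℕ.< s → a * s ≤ p * (c′ * a′) → p * (c * t′) ≤ t * s →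
             x * a′ ≤ y * t′ → c * x * a ≤ c′ * y * t
ratio-step {a} {a′} {t} {t′} {s} {p} {c} {c′} {x} {y} 0<s upper lower ih =
  *-cancelʳ-≤ (c * x * a) (c′ * y * t) s {{ℕ.>-nonZero 0<s}} (begin
    c * x * a * s           ≡⟨ *-assoc (c * x) a s ⟩
    c * x * (a * s)         ≤⟨ *-monoʳ-≤ (c * x) upper ⟩
    c * x * (p * (c′ * a′)) ≡⟨ shuffle₁ c x p c′ a′ ⟩
    p * c′ * c * (x * a′)   ≤⟨ *-monoʳ-≤ (p * c′ * c) ih ⟩
    p * c′ * c * (y * t′)   ≡⟨ shuffle₂ c′ y p c t′ ⟩
    c′ * y * (p * (c * t′)) ≤⟨ *-monoʳ-≤ (c′ * y) lower ⟩
    c′ * y * (t * s)        ≡⟨ *-assoc (c′ * y) t s ⟨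
    c′ * y * t * s          ∎)
  where
  open ≤-Reasoning
  shuffle₁ : ∀ c x p c′ a′ → c * x * (p * (c′ * a′)) ≡ p * c′ * c * (x * a′)
  shuffle₁ = solve-∀
  shuffle₂ : ∀ c′ y p c t′ → p * c′ * c * (y * t′) ≡ c′ * y * (p * (c * t′))
  shuffle₂ = solve-∀

cancel-ratio : ∀ {k x y a t} → k * x ≤ y → y * a ≤ x * t → 0 ℕ.< y → k * a ≤ t
cancel-ratio {k} {zero} {y} {a} {t} _ y*a≤0 0<y = subst (_≤ t) (sym (trans (cong (k *_) a≡0) (*-zeroʳ k))) z≤n
  where
  a≡0 : a ≡ 0
  a≡0 = n≤0⇒n≡0 (≤-trans (m≤n*m a y {{ℕ.>-nonZero 0<y}}) y*a≤0)
cancel-ratio {k} {x@(suc _)} {y} {a} {t} k*x≤y y*a≤x*t _ = *-cancelʳ-≤ (k * a) t x (begin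
  k * a * x  ≡⟨ swap k a x ⟩
  k * x * a  ≤⟨ *-monoˡ-≤ a k*x≤y ⟩
  y * a      ≤⟨ y*a≤x*t ⟩
  x * t      ≡⟨ *-comm x t ⟩
  t * x      ∎)
  where
  open ≤-Reasoning
  swap : ∀ k a x → k * a * x ≡ k * x * a
  swap = solve-∀

-- The recurrence

module Recurrence (r : ℕ) {{_ : NonZero r}} (m : ℕ) (H : Vec (Fin m) (r * m)) where

  Labellings : (n : ℕ) → Listing (Vec (Fin n) (r * n))
  Labellings n = Listing-Vec (Listing-Fin n) (r * n)

  Subsets : (n : ℕ) → Listing (Subset n)
  Subsets n = Listing-Vec Listing-Bool n

  Avoiding : (n : ℕ) → Vec (Fin n) (r * n) → Set
  Avoiding n M = IsMatching r n M × ¬ Contains r m n H M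

  avoiding? : (n : ℕ) → Decidable (Avoiding n)
  avoiding? n M = isMatching? r n M ×-dec ¬? (contains? r m n H M)

  OfSize : (n s : ℕ) → Subset n → Set
  OfSize n s F = ∣ F ∣ ≡ s

  size? : (n s : ℕ) → Decidable (OfSize n s)
  size? n s F = ∣ F ∣ ℕ.≟ s

  T A : ℕ → ℕ
  T = numMatchings r
  A = numAvoiding r m H

  T≡# : ∀ n → T n ≡ #[ Labellings n ] (isMatching? r n)
  T≡# n = countVec≡# (r * n) n (isMatching? r n)

  A≡# : ∀ n → A n ≡ #[ Labellings n ] (avoiding? n)
  A≡# n = countVec≡# (r * n) n (avoiding? n)

  edgeChoices : ℕ → ℕ
  edgeChoices n = #[ Subsets n ] (size? n m)

  vertexChoices : ℕ → ℕ
  vertexChoices n = #[ Subsets (r * n) ] (size? (r * n) (r * m))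

  module _ (n′ : ℕ) where
    open Splitting r m n′

    Pairs : Listing (Vec (Fin n) (r * n) × Subset n)
    Pairs = Labellings n ×ₗ Subsets n

    Triples : Listing Triple
    Triples = Subsets (r * n) ×ₗ (Labellings m ×ₗ Labellings n′)

    avoiding-recurrence : A (m + n′) * edgeChoices (m + n′) ≤ vertexChoices (m + n′) * (A m * A n′)
    avoiding-recurrence = begin
      A n * edgeChoices n
        ≡⟨ cong (_* edgeChoices n) (A≡# n) ⟩
      #[ Labellings n ] (avoiding? n) * edgeChoices n
        ≡⟨ #-× (Labellings n) (Subsets n) (avoiding? n) (size? n m) ⟨
      #[ Pairs ] (avoiding? n ×? size? n m)
        ≤⟨ #-injection Pairs Triples (avoiding? n ×? size? n m)
                       (size? (r * n) (r * m) ×? (avoiding? m ×? avoiding? n′))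
                       split′ split′-avoiding split′-injective ⟩
      #[ Triples ] (size? (r * n) (r * m) ×? (avoiding? m ×? avoiding? n′))
        ≡⟨ #-× (Subsets (r * n)) (Labellings m ×ₗ Labellings n′) (size? (r * n) (r * m))
               (avoiding? m ×? avoiding? n′) ⟩
      vertexChoices n * #[ Labellings m ×ₗ Labellings n′ ] (avoiding? m ×? avoiding? n′)
        ≡⟨ cong (vertexChoices n *_) (#-× (Labellings m) (Labellings n′) (avoiding? m) (avoiding? n′)) ⟩
      vertexChoices n * (#[ Labellings m ] (avoiding? m) * #[ Labellings n′ ] (avoiding? n′))
        ≡⟨ cong (vertexChoices n *_) (cong₂ _*_ (A≡# m) (A≡# n′)) ⟨
      vertexChoices n * (A m * A n′) ∎
      where
      open ≤-Reasoning
      ValidPair : Vec (Fin n) (r * n) × Subset n → Set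
      ValidPair = Avoiding n ⟨×⟩ OfSize n m
      split′ : ∀ x → ValidPair x → Triple
      split′ (M , F) ((M-matching , _) , ∣F∣≡m) = split M F (proj₁ M-matching) ∣F∣≡m
      split′-avoiding : ∀ x (p : ValidPair x) →
                        (OfSize (r * n) (r * m) ⟨×⟩ (Avoiding m ⟨×⟩ Avoiding n′)) (split′ x p)
      split′-avoiding (M , F) ((M-matching , M-avoids) , ∣F∣≡m) =
        ∣U∣≡ , (proj₁ matchings , proj₁ avoids) , (proj₂ matchings , proj₂ avoids)
        where
        open Split M F (proj₁ M-matching) ∣F∣≡m
        matchings : IsMatching r m Inside.restriction × IsMatching r n′ Outside.restriction
        matchings = split-matchings M F M-matching ∣F∣≡m
        avoids : ¬ Contains r m m H Inside.restriction × ¬ Contains r m n′ H Outside.restriction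
        avoids = split-avoids M F M-matching ∣F∣≡m H M-avoids
      split′-injective : ∀ x x′ (p : ValidPair x) (p′ : ValidPair x′) → split′ x p ≡ split′ x′ p′ → x ≡ x′
      split′-injective (M , F) (M′ , F′) ((M-matching , _) , e) ((M′-matching , _) , e′) same =
        let M≡M′ , F≡F′ = split-injective M M′ F F′ M-matching M′-matching e e′ same
        in  cong₂ _,_ M≡M′ F≡F′

    matching-recurrence : vertexChoices (m + n′) * (T m * T n′) ≤ T (m + n′) * edgeChoices (m + n′)
    matching-recurrence = begin
      vertexChoices n * (T m * T n′)
        ≡⟨ cong (vertexChoices n *_) (cong₂ _*_ (T≡# m) (T≡# n′)) ⟩
      vertexChoices n * (#[ Labellings m ] (isMatching? r m) * #[ Labellings n′ ] (isMatching? r n′))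
        ≡⟨ cong (vertexChoices n *_) (#-× (Labellings m) (Labellings n′) (isMatching? r m) (isMatching? r n′)) ⟨
      vertexChoices n * #[ Labellings m ×ₗ Labellings n′ ] (isMatching? r m ×? isMatching? r n′)
        ≡⟨ #-× (Subsets (r * n)) (Labellings m ×ₗ Labellings n′) (size? (r * n) (r * m))
               (isMatching? r m ×? isMatching? r n′) ⟨
      #[ Triples ] (size? (r * n) (r * m) ×? (isMatching? r m ×? isMatching? r n′))
        ≤⟨ #-injection Triples Pairs (size? (r * n) (r * m) ×? (isMatching? r m ×? isMatching? r n′))
                       (isMatching? r n ×? size? n m) merge′ merge′-matching merge′-injective ⟩
      #[ Pairs ] (isMatching? r n ×? size? n m)
        ≡⟨ #-× (Labellings n) (Subsets n) (isMatching? r n) (size? n m) ⟩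
      #[ Labellings n ] (isMatching? r n) * edgeChoices n
        ≡⟨ cong (_* edgeChoices n) (T≡# n) ⟨
      T n * edgeChoices n ∎
      where
      open ≤-Reasoning
      ValidTriple : Triple → Set
      ValidTriple = OfSize (r * n) (r * m) ⟨×⟩ (IsMatching r m ⟨×⟩ IsMatching r n′)
      merge′ : ∀ t → ValidTriple t → Vec (Fin n) (r * n) × Subset n
      merge′ (U , M₁ , M₂) (∣U∣≡ , m₁ , m₂) = merged , edges₁
        where open Merge U M₁ M₂ ∣U∣≡ m₁ m₂
      merge′-matching : ∀ t (p : ValidTriple t) → (IsMatching r n ⟨×⟩ OfSize n m) (merge′ t p)
      merge′-matching (U , M₁ , M₂) (∣U∣≡ , m₁ , m₂) = merged-matching , ∣edges₁∣≡m
        where open Merge U M₁ M₂ ∣U∣≡ m₁ m₂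
      merge′-injective : ∀ t t′ (p : ValidTriple t) (p′ : ValidTriple t′) → merge′ t p ≡ merge′ t′ p′ → t ≡ t′
      merge′-injective (U , M₁ , M₂) (U′ , M₁′ , M₂′) (∣U∣≡ , m₁ , m₂) (∣U′∣≡ , m₁′ , m₂′) same =
        trans (sym Ψ.split-merge)
              (trans (split-cong (cong proj₁ same) (cong proj₂ same)
                                 (proj₁ Ψ.merged-matching) (proj₁ Ψ′.merged-matching) Ψ.∣edges₁∣≡m Ψ′.∣edges₁∣≡m)
                     Ψ′.split-merge)
        where
        module Ψ  = Merge U M₁ M₂ ∣U∣≡ m₁ m₂
        module Ψ′ = Merge U′ M₁′ M₂′ ∣U′∣≡ m₁′ m₂′

  edgeChoices-positive : ∀ n′ → 0 ℕ.< edgeChoices (m + n′)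
  edgeChoices-positive n′ =
    #-positive (Subsets (m + n′)) (size? (m + n′) m) (full {m} Vec.++ empty {n′}) (∣full++empty∣ m n′)
    where
    ∣full++empty∣ : ∀ a b → ∣ full {a} Vec.++ empty {b} ∣ ≡ a
    ∣full++empty∣ zero    b = ∣⊥∣≡0 b
    ∣full++empty∣ (suc a) b = cong suc (∣full++empty∣ a b)

  A≤T : ∀ n → A n ≤ T n
  A≤T n = subst₂ _≤_ (sym (A≡# n)) (sym (T≡# n))
    (#-injection (Labellings n) (Labellings n) (avoiding? n) (isMatching? r n)
                 (λ M _ → M) (λ _ → proj₁) (λ _ _ _ _ → id))

  Aₘ<Tₘ : IsMatching r m H → A m ℕ.< T m
  Aₘ<Tₘ H-matching = subst₂ ℕ._<_ (sym (A≡# m)) (sym (T≡# m))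
    (#-< (Labellings m) (avoiding? m) (isMatching? r m) H proj₁ H-matching
         (λ (_ , H-avoids) → H-avoids (Contains-refl {r = r} H)))

  decay-step : ∀ j n′ → T m ^ j * A n′ ≤ A m ^ j * T n′ →
               T m ^ suc j * A (m + n′) ≤ A m ^ suc j * T (m + n′)
  decay-step j n′ = ratio-step {a = A (m + n′)} {a′ = A n′} {t = T (m + n′)} {t′ = T n′}
    {s = edgeChoices (m + n′)} {p = vertexChoices (m + n′)} {c = T m} {c′ = A m} {x = T m ^ j} {y = A m ^ j}
    (edgeChoices-positive n′) (avoiding-recurrence n′) (matching-recurrence n′)

  decay : ∀ j n → j * m ≤ n → T m ^ j * A n ≤ A m ^ j * T n
  decay zero    n _      = subst₂ _≤_ (sym (*-identityˡ (A n))) (sym (*-identityˡ (T n))) (A≤T n)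
  decay (suc j) n m+jm≤n = subst (λ n → T m ^ suc j * A n ≤ A m ^ suc j * T n) (m+[n∸m]≡n m≤n)
    (decay-step j (n ∸ m) (decay j (n ∸ m) jm≤n∸m))
    where
    m≤n : m ≤ n
    m≤n = m+n≤o⇒m≤o m m+jm≤n
    jm≤n∸m : j * m ≤ n ∸ m
    jm≤n∸m = m+n≤o⇒m≤o∸n (j * m) (subst (_≤ n) (+-comm m (j * m)) m+jm≤n)

proposition2 : (r : ℕ) → 2 ≤ r → (m : ℕ) → (H : Vec (Fin m) (r * m)) → IsMatching r m H →
    (k : ℕ) → ∃ λ N → (n : ℕ) → N ≤ n → k * numAvoiding r m H n ≤ numMatchings r n
proposition2 r 2≤r m H H-matching k = j * m , λ n jm≤n →
  cancel-ratio {k = k} {x = A m ^ j} {y = T m ^ j} {a = A n} {t = T n}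
               k*Aₘʲ≤Tₘʲ (decay j n jm≤n) (m^n>0 (T m) j)
  where
  instance
    r≢0 : NonZero r
    r≢0 = ℕ.>-nonZero (≤-trans (s≤s z≤n) 2≤r)
  open Recurrence r m H
  instance
    Tₘ≢0 : NonZero (T m)
    Tₘ≢0 = ℕ.>-nonZero (≤-trans (s≤s z≤n) (Aₘ<Tₘ H-matching))
  gap : ∃ λ j → k * A m ^ j ≤ T m ^ j
  gap = pow-gap (Aₘ<Tₘ H-matching) k
  j : ℕ
  j = proj₁ gap
  k*Aₘʲ≤Tₘʲ : k * A m ^ j ≤ T m ^ j
  k*Aₘʲ≤Tₘʲ = proj₂ gap
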